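{- Let $\mathbf{B}$ be a connected bimonoid in pointed set species. Then for all disjoint finite sets $N,M$ and all $\mathbf{x}\in\mathbf{B}_N$, $\mathbf{y}\in\mathbf{B}_M$, we have $\mathbf{x}\cdot\mathbf{y}=0$ if and only if $\mathbf{x}=0$ or $\mathbf{y}=0$.
   Context: A pointed set species is a functor from finite sets with bijections to pointed sets (base point denoted $0$); it is connected if $\mathbf{B}_\emptyset=\{0,1\}$ has two elements. A monoid structure consists of products $\mathbf{B}_S\times\mathbf{B}_T\to\mathbf{B}_{S\sqcup T}$ for disjoint $S,T$ that are natural under relabeling, associative, unital ($1\cdot\mathbf{x}=\mathbf{x}=\mathbf{x}\cdot1$) and absorbing ($\mathbf{x}\cdot\mathbf{y}=0$ if $\mathbf{x}=0$ or $\mathbf{y}=0$). A comonoid structure consists of, for $N=S\sqcup T$ and $\mathbf{x}\in\mathbf{B}_N$, a restriction $\mathbf{x}|_S\in\mathbf{B}_S$ and contraction $\mathbf{x}/S\in\mathbf{B}_T$, natural under relabeling, with coassociativity (for $R\subseteq S$: $\mathbf{x}|_S/R=(\mathbf{x}/R)|_{S\setminus R}$, and if this is nonzero then $(\mathbf{x}|_S)|_R=\mathbf{x}|_R$ and $\mathbf{x}/S=(\mathbf{x}/R)/(S\setminus R)$), counitality ($\mathbf{x}|_N=\mathbf{x}=\mathbf{x}/\emptyset$), and zero conditions ($\mathbf{x}|_S=0$ iff $\mathbf{x}/S=0$; $0|_S=0/S=0$). A bimonoid is a species with both structures such that for every $N=S\sqcup T$, $S'\subseteq N$, $\mathbf{x}\in\mathbf{B}_S$,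 $\mathbf{y}\in\mathbf{B}_T$: $(\mathbf{x}\cdot\mathbf{y})|_{S'}=\mathbf{x}|_{S\cap S'}\cdot\mathbf{y}|_{T\cap S'}$ and $(\mathbf{x}\cdot\mathbf{y})/S'=\mathbf{x}/(S\cap S')\cdot\mathbf{y}/(T\cap S')$; and $1\neq0$. -}

module Defs where

open import Level using (0ℓ)
open import Data.Bool using (Bool; true; false; not)
open import Data.Bool.Properties using () renaming (_≟_ to _≟B_)
open import Data.Empty using (⊥)
open import Data.Sum using (_⊎_; inj₁; inj₂)
open import Data.Sum.Properties using (≡-dec)
open import Data.Sum.Algebra using (⊎-assoc)
open import Data.Sum.Function.Propositional using (_⊎-↔_)
open import Data.Product using (Σ; _,_; proj₁; proj₂; _×_)
open import Data.List using (List; []; _∷_; _++_; map)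
open import Data.List.Membership.Propositional using (_∈_)
open import Data.List.Membership.Propositional.Properties using (∈-++⁺ˡ; ∈-++⁺ʳ; ∈-map⁺)
open import Data.List.Relation.Unary.Any using (here; there)
open import Function using (_∘_)
open import Function.Bundles using (_↔_; Inverse; mk↔ₛ′)
open import Function.Construct.Identity using (↔-id)
open import Function.Construct.Composition using (_↔-∘_)
open import Relation.Binary.Definitions using (DecidableEquality)
open import Relation.Binary.PropositionalEquality
open import Relation.Nullary using (¬_; yes; no)
open import Axiom.UniquenessOfIdentityProofs using (module Decidable⇒UIP)

-- Finite sets (Bishop-finite: decidable equality + a complete listing)

record FinSet : Set₁ where
  field
    Carrier  : Set
    _≟_      : DecidableEquality Carrier
    elems    : List Carrier
    complete : ∀ x → x ∈ elems

open FinSet public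

Sub : FinSet → Set
Sub N = Carrier N → Bool

∅ : FinSet
∅ = record { Carrier = ⊥ ; _≟_ = λ () ; elems = [] ; complete = λ () }

_⊕_ : FinSet → FinSet → FinSet
S ⊕ T = record
  { Carrier  = Carrier S ⊎ Carrier T
  ; _≟_      = ≡-dec (_≟_ S) (_≟_ T)
  ; elems    = map inj₁ (elems S) ++ map inj₂ (elems T)
  ; complete = λ { (inj₁ a) → ∈-++⁺ˡ (∈-map⁺ inj₁ (complete S a))
                 ; (inj₂ b) → ∈-++⁺ʳ (map inj₁ (elems S)) (∈-map⁺ inj₂ (complete T b)) } }

record _≅_ (N M : FinSet) : Set where
  constructor iso
  field
    bij : Carrier N ↔ Carrier M

open _≅_ public

⟦_⟧ : {N M : FinSet} → N ≅ M → Carrier N → Carrier M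
⟦ f ⟧ = Inverse.to (bij f)

id≅ : (N : FinSet) → N ≅ N
id≅ N = iso (↔-id (Carrier N))

_∘≅_ : {N M K : FinSet} → M ≅ K → N ≅ M → N ≅ K
g ∘≅ f = iso (bij g ↔-∘ bij f)

_⊕≅_ : {S S' T T' : FinSet} → S ≅ S' → T ≅ T' → (S ⊕ T) ≅ (S' ⊕ T')
f ⊕≅ g = iso (bij f ⊎-↔ bij g)

assoc≅ : (R S T : FinSet) → ((R ⊕ S) ⊕ T) ≅ (R ⊕ (S ⊕ T))
assoc≅ R S T = iso (⊎-assoc 0ℓ (Carrier R) (Carrier S) (Carrier T))

bool-irr : {b : Bool} (p q : b ≡ true) → p ≡ q
bool-irr = Decidable⇒UIP.≡-irrelevant _≟B_

module _ {A : Set} (P : A → Bool) where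

  Σ-ext : {u v : Σ A (λ a → P a ≡ true)} → proj₁ u ≡ proj₁ v → u ≡ v
  Σ-ext {a , p} {.a , q} refl = cong (a ,_) (bool-irr p q)

  private
    cons : (a : A) (b : Bool) → P a ≡ b → List (Σ A (λ a → P a ≡ true))
         → List (Σ A (λ a → P a ≡ true))
    cons a true  e l = (a , e) ∷ l
    cons a false e l = l

  sublist : List A → List (Σ A (λ a → P a ≡ true))
  sublist []       = []
  sublist (a ∷ as) = cons a (P a) refl (sublist as)

  private
    cons-there : ∀ a b (e : P a ≡ b) l {u} → u ∈ l → u ∈ cons a b e l
    cons-there a true  e l m = there m
    cons-there a false e l m = m

    cons-here : ∀ a b (e : P a ≡ b) l (p : P a ≡ true) → (a , p) ∈ cons a b e l
    cons-here a true  e l p = here (Σ-ext refl)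
    cons-here a false e l p with trans (sym p) e
    ... | ()

  sublist-complete : ∀ {a} (p : P a ≡ true) (l : List A) → a ∈ l → (a , p) ∈ sublist l
  sublist-complete p (b ∷ l) (here refl) = cons-here b (P b) refl (sublist l) p
  sublist-complete p (b ∷ l) (there m)   = cons-there b (P b) refl (sublist l) (sublist-complete p l m)

_∣_ : (N : FinSet) → Sub N → FinSet
N ∣ P = record
  { Carrier  = Σ (Carrier N) (λ a → P a ≡ true)
  ; _≟_      = dec
  ; elems    = sublist P (elems N)
  ; complete = λ { (a , p) → sublist-complete P p (elems N) (complete N a) } }
  where
  dec : DecidableEquality (Σ (Carrier N) (λ a → P a ≡ true))
  dec (a , p) (b , q) with _≟_ N a b
  ... | yes refl = yes (Σ-ext P refl)
  ... | no a≢b   = no (λ e → a≢b (cong proj₁ e))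

sub≅ : {N M : FinSet} (f : N ≅ M) (P : Sub M) → (N ∣ (P ∘ ⟦ f ⟧)) ≅ (M ∣ P)
sub≅ {N} {M} f P = iso (mk↔ₛ′ to' from' invˡ invʳ)
  where
  open Inverse (bij f) using (to; from; strictlyInverseˡ; strictlyInverseʳ)
  to' : Carrier (N ∣ (P ∘ to)) → Carrier (M ∣ P)
  to' (a , p) = to a , p
  from' : Carrier (M ∣ P) → Carrier (N ∣ (P ∘ to))
  from' (b , p) = from b , trans (cong P (strictlyInverseˡ b)) p
  invˡ : ∀ y → to' (from' y) ≡ y
  invˡ (b , p) = Σ-ext P (strictlyInverseˡ b)
  invʳ : ∀ x → from' (to' x) ≡ x
  invʳ (a , p) = Σ-ext (P ∘ to) (strictlyInverseʳ a)

full≅ : (N : FinSet) → (N ∣ (λ _ → true)) ≅ N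
full≅ N = iso (mk↔ₛ′ proj₁ (λ a → a , refl) (λ _ → refl) (λ _ → Σ-ext (λ _ → true) refl))

split≅ : (S T : FinSet) (P : Sub (S ⊕ T))
       → ((S ∣ (P ∘ inj₁)) ⊕ (T ∣ (P ∘ inj₂))) ≅ ((S ⊕ T) ∣ P)
split≅ S T P = iso (mk↔ₛ′ to' from' invˡ invʳ)
  where
  to' : Carrier ((S ∣ (P ∘ inj₁)) ⊕ (T ∣ (P ∘ inj₂))) → Carrier ((S ⊕ T) ∣ P)
  to' (inj₁ (a , p)) = inj₁ a , p
  to' (inj₂ (b , p)) = inj₂ b , p
  from' : Carrier ((S ⊕ T) ∣ P) → Carrier ((S ∣ (P ∘ inj₁)) ⊕ (T ∣ (P ∘ inj₂)))
  from' (inj₁ a , p) = inj₁ (a , p)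
  from' (inj₂ b , p) = inj₂ (b , p)
  invˡ : ∀ y → to' (from' y) ≡ y
  invˡ (inj₁ a , p) = refl
  invˡ (inj₂ b , p) = refl
  invʳ : ∀ x → from' (to' x) ≡ x
  invʳ (inj₁ _) = refl
  invʳ (inj₂ _) = refl

unitˡ≅ : (S : FinSet) → (∅ ⊕ S) ≅ S
unitˡ≅ S = iso (mk↔ₛ′ to' inj₂ (λ _ → refl) inv)
  where
  to' : ⊥ ⊎ Carrier S → Carrier S
  to' (inj₂ a) = a
  inv : ∀ x → inj₂ (to' x) ≡ x
  inv (inj₂ a) = refl

unitʳ≅ : (S : FinSet) → (S ⊕ ∅) ≅ S
unitʳ≅ S = iso (mk↔ₛ′ to' inj₁ (λ _ → refl) inv)
  where
  to' : Carrier S ⊎ ⊥ → Carrier S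
  to' (inj₁ a) = a
  inv : ∀ x → inj₁ (to' x) ≡ x
  inv (inj₁ a) = refl

-- For R ⊆ S ⊆ N (R, S given as subsets of N):
-- R viewed as a subset of S, and S viewed as a subset of N ∖ R
inS : (N : FinSet) (S R : Sub N) → Sub (N ∣ S)
inS N S R = R ∘ proj₁

coassoc≅₁ : (N : FinSet) (R S : Sub N)
          → ((N ∣ S) ∣ (not ∘ inS N S R)) ≅ ((N ∣ (not ∘ R)) ∣ inS N (not ∘ R) S)
coassoc≅₁ N R S = iso (mk↔ₛ′ (λ { ((a , s) , r) → (a , r) , s })
                        (λ { ((a , r) , s) → (a , s) , r })
                        (λ _ → refl) (λ _ → refl))

coassoc≅₂ : (N : FinSet) (R S : Sub N) → (∀ a → R a ≡ true → S a ≡ true)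
          → (N ∣ R) ≅ ((N ∣ S) ∣ inS N S R)
coassoc≅₂ N R S R⊆S = iso (mk↔ₛ′ (λ { (a , r) → (a , R⊆S a r) , r })
                            (λ { ((a , s) , r) → a , r })
                            (λ { ((a , s) , r) → Σ-ext (inS N S R) (Σ-ext S refl) })
                            (λ _ → refl))

coassoc≅₃ : (N : FinSet) (R S : Sub N) → (∀ a → R a ≡ true → S a ≡ true)
          → ((N ∣ (not ∘ R)) ∣ (not ∘ inS N (not ∘ R) S)) ≅ (N ∣ (not ∘ S))
coassoc≅₃ N R S R⊆S = iso (mk↔ₛ′ (λ { ((a , r) , s) → a , s })
                            (λ { (a , s) → (a , lemma a s) , s })
                            (λ _ → refl)
                            (λ { ((a , r) , s) → Σ-ext (not ∘ inS N (not ∘ R) S) (Σ-ext (not ∘ R) refl) }))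
  where
  lemma : ∀ a → not (S a) ≡ true → not (R a) ≡ true
  lemma a ns with R a in eq
  ... | false = refl
  ... | true with S a | R⊆S a eq
  ...   | true | _ = ns

record PointedSpecies : Set₁ where
  field
    B       : FinSet → Set
    0#      : ∀ {N} → B N
    relabel : ∀ {N M} → N ≅ M → B N → B M
    relabel-id   : ∀ {N} (x : B N) → relabel (id≅ N) x ≡ x
    relabel-∘    : ∀ {N M K} (g : M ≅ K) (f : N ≅ M) (x : B N)
                 → relabel (g ∘≅ f) x ≡ relabel g (relabel f x)
    relabel-ext  : ∀ {N M} (f g : N ≅ M) → (∀ a → ⟦ f ⟧ a ≡ ⟦ g ⟧ a)
                 → ∀ x → relabel f x ≡ relabel g x
    relabel-0    : ∀ {N M} (f : N ≅ M) → relabel f (0# {N}) ≡ 0#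

record IsMonoid (𝔹 : PointedSpecies) : Set₁ where
  open PointedSpecies 𝔹
  field
    _·_ : ∀ {S T} → B S → B T → B (S ⊕ T)
    1#  : B ∅
    ·-natural : ∀ {S S' T T'} (f : S ≅ S') (g : T ≅ T') (x : B S) (y : B T)
              → relabel (f ⊕≅ g) (x · y) ≡ relabel f x · relabel g y
    ·-assoc   : ∀ {R S T} (x : B R) (y : B S) (z : B T)
              → relabel (assoc≅ R S T) ((x · y) · z) ≡ x · (y · z)
    ·-unitˡ   : ∀ {S} (x : B S) → relabel (unitˡ≅ S) (1# · x) ≡ x
    ·-unitʳ   : ∀ {S} (x : B S) → relabel (unitʳ≅ S) (x · 1#) ≡ x
    ·-absorbˡ : ∀ {S T} (y : B T) → (0# {S}) · y ≡ 0#
    ·-absorbʳ : ∀ {S T} (x : B S) → x · (0# {T}) ≡ 0#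

-- Comonoid structure: restriction x|_S and contraction x/S
record IsComonoid (𝔹 : PointedSpecies) : Set₁ where
  open PointedSpecies 𝔹
  field
    restrict : ∀ (N : FinSet) (S : Sub N) → B N → B (N ∣ S)
    contract : ∀ (N : FinSet) (S : Sub N) → B N → B (N ∣ (not ∘ S))
    restrict-natural : ∀ {N M} (f : N ≅ M) (S : Sub M) (x : B N)
      → restrict M S (relabel f x) ≡ relabel (sub≅ f S) (restrict N (S ∘ ⟦ f ⟧) x)
    contract-natural : ∀ {N M} (f : N ≅ M) (S : Sub M) (x : B N)
      → contract M S (relabel f x) ≡ relabel (sub≅ f (not ∘ S)) (contract N (S ∘ ⟦ f ⟧) x)
    coassoc₁ : ∀ {N} (R S : Sub N) → (∀ a → R a ≡ true → S a ≡ true) → (x : B N)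
      → relabel (coassoc≅₁ N R S) (contract (N ∣ S) (inS N S R) (restrict N S x))
        ≡ restrict (N ∣ (not ∘ R)) (inS N (not ∘ R) S) (contract N R x)
    coassoc₂ : ∀ {N} (R S : Sub N) (R⊆S : ∀ a → R a ≡ true → S a ≡ true) (x : B N)
      → ¬ (contract (N ∣ S) (inS N S R) (restrict N S x) ≡ 0#)
      → restrict (N ∣ S) (inS N S R) (restrict N S x) ≡ relabel (coassoc≅₂ N R S R⊆S) (restrict N R x)
    coassoc₃ : ∀ {N} (R S : Sub N) (R⊆S : ∀ a → R a ≡ true → S a ≡ true) (x : B N)
      → ¬ (contract (N ∣ S) (inS N S R) (restrict N S x) ≡ 0#)
      → contract N S x ≡ relabel (coassoc≅₃ N R S R⊆S) (contract (N ∣ (not ∘ R)) (inS N (not ∘ R) S) (contract N R x))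
    counit-restrict : ∀ {N} (x : B N) → relabel (full≅ N) (restrict N (λ _ → true) x) ≡ x
    counit-contract : ∀ {N} (x : B N) → relabel (full≅ N) (contract N (λ _ → false) x) ≡ x
    restrict-zero⇒ : ∀ {N} (S : Sub N) (x : B N) → restrict N S x ≡ 0# → contract N S x ≡ 0#
    contract-zero⇒ : ∀ {N} (S : Sub N) (x : B N) → contract N S x ≡ 0# → restrict N S x ≡ 0#
    restrict-0 : ∀ {N} (S : Sub N) → restrict N S (0# {N}) ≡ 0#
    contract-0 : ∀ {N} (S : Sub N) → contract N S (0# {N}) ≡ 0#

record IsBimonoid (𝔹 : PointedSpecies) : Set₁ where
  open PointedSpecies 𝔹
  field
    isMonoid   : IsMonoid 𝔹
    isComonoid : IsComonoid 𝔹
  open IsMonoid isMonoid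
  open IsComonoid isComonoid
  field
    restrict-· : ∀ {S T} (S' : Sub (S ⊕ T)) (x : B S) (y : B T)
      → restrict (S ⊕ T) S' (x · y) ≡ relabel (split≅ S T S') (restrict S (S' ∘ inj₁) x · restrict T (S' ∘ inj₂) y)
    contract-· : ∀ {S T} (S' : Sub (S ⊕ T)) (x : B S) (y : B T)
      → contract (S ⊕ T) S' (x · y) ≡ relabel (split≅ S T (not ∘ S')) (contract S (S' ∘ inj₁) x · contract T (S' ∘ inj₂) y)
    1≢0 : ¬ (1# ≡ 0#)

IsConnected : (𝔹 : PointedSpecies) → IsMonoid 𝔹 → Set
IsConnected 𝔹 m = ∀ (z : PointedSpecies.B 𝔹 ∅) → z ≡ PointedSpecies.0# 𝔹 ⊎ z ≡ IsMonoid.1# m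

module Submission where

open import Defs
open import Data.Sum using (_⊎_)
open import Data.Product using (_×_)
open import Relation.Binary.PropositionalEquality using (_≡_)

open import Data.Sum using (inj₁; inj₂; [_,_])
open import Data.Product using (_,_)
open import Data.Bool using (true; false)
open import Function using (_∘_)
open import Function.Bundles using (Inverse; mk↔ₛ′)
open import Function.Construct.Symmetry using (↔-sym)
open import Relation.Binary.PropositionalEquality using (refl; sym; trans; cong; cong₂; module ≡-Reasoning)

-- Restricting x · y = 0 to N gives x|N · y|∅ = 0, and by connectedness y|∅ ∈ B∅ is 0 or 1.
-- If y|∅ = 0 then y = y/∅ = 0 by the zero conditions; if y|∅ = 1 then x = x|N = x|N · 1 = 0.

sym≅ : {N M : FinSet} → N ≅ M → M ≅ N
sym≅ f = iso (↔-sym (bij f))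

none≅∅ : (N : FinSet) → (N ∣ (λ _ → false)) ≅ ∅
none≅∅ N = iso (mk↔ₛ′ (λ { (_ , ()) }) (λ ()) (λ ()) (λ { (_ , ()) }))

module PointedSpeciesProperties (𝔹 : PointedSpecies) where
  open PointedSpecies 𝔹

  relabel-inverseʳ : ∀ {N M} (f : N ≅ M) (x : B N) → relabel (sym≅ f) (relabel f x) ≡ x
  relabel-inverseʳ {N} f x = begin
    relabel (sym≅ f) (relabel f x) ≡⟨ relabel-∘ (sym≅ f) f x ⟨
    relabel (sym≅ f ∘≅ f) x        ≡⟨ relabel-ext _ (id≅ N) (Inverse.strictlyInverseʳ (bij f)) x ⟩
    relabel (id≅ N) x              ≡⟨ relabel-id x ⟩
    x                              ∎
    where open ≡-Reasoning

  relabel≡0⇒≡0 : ∀ {N M} (f : N ≅ M) {x : B N} → relabel f x ≡ 0# → x ≡ 0#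
  relabel≡0⇒≡0 f {x} fx≡0 = begin
    x                              ≡⟨ relabel-inverseʳ f x ⟨
    relabel (sym≅ f) (relabel f x) ≡⟨ cong (relabel (sym≅ f)) fx≡0 ⟩
    relabel (sym≅ f) 0#            ≡⟨ relabel-0 (sym≅ f) ⟩
    0#                             ∎
    where open ≡-Reasoning

  relabel-preserves-0 : ∀ {N M} (f : N ≅ M) {x : B N} → x ≡ 0# → relabel f x ≡ 0#
  relabel-preserves-0 f refl = relabel-0 f

module MonoidProperties {𝔹 : PointedSpecies} (monoid : IsMonoid 𝔹) where
  open PointedSpecies 𝔹
  open IsMonoid monoid
  open PointedSpeciesProperties 𝔹

  ·-cancel-unitʳ : ∀ {S T} (x : B S) {u : B T} (f : T ≅ ∅) → relabel f u ≡ 1# → x · u ≡ 0# → x ≡ 0#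
  ·-cancel-unitʳ {S} x {u} f fu≡1 xu≡0 = begin
    x                           ≡⟨ ·-unitʳ x ⟨
    relabel (unitʳ≅ S) (x · 1#) ≡⟨ relabel-preserves-0 (unitʳ≅ S) x·1≡0 ⟩
    0#                          ∎
    where
    open ≡-Reasoning
    relabel-x·u : relabel (id≅ S ⊕≅ f) (x · u) ≡ x · 1#
    relabel-x·u = trans (·-natural (id≅ S) f x u) (cong₂ _·_ (relabel-id x) fu≡1)
    x·1≡0 : x · 1# ≡ 0#
    x·1≡0 = trans (sym relabel-x·u) (relabel-preserves-0 (id≅ S ⊕≅ f) xu≡0)

module ComonoidProperties {𝔹 : PointedSpecies} (comonoid : IsComonoid 𝔹) where
  open PointedSpecies 𝔹
  open IsComonoid comonoid
  open PointedSpeciesProperties 𝔹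

  restrict-all≡0⇒≡0 : ∀ {N} (x : B N) → restrict N (λ _ → true) x ≡ 0# → x ≡ 0#
  restrict-all≡0⇒≡0 {N} x x|N≡0 =
    trans (sym (counit-restrict x)) (relabel-preserves-0 (full≅ N) x|N≡0)

  restrict-none≡0⇒≡0 : ∀ {N} (x : B N) → restrict N (λ _ → false) x ≡ 0# → x ≡ 0#
  restrict-none≡0⇒≡0 {N} x x|∅≡0 =
    trans (sym (counit-contract x)) (relabel-preserves-0 (full≅ N) (restrict-zero⇒ _ x x|∅≡0))

module BimonoidProperties {𝔹 : PointedSpecies} (bimonoid : IsBimonoid 𝔹) where
  open PointedSpecies 𝔹
  open IsBimonoid bimonoid
  open IsMonoid isMonoid
  open IsComonoid isComonoid
  open PointedSpeciesProperties 𝔹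
  open MonoidProperties isMonoid
  open ComonoidProperties isComonoid

  restrict-·≡0 : ∀ {S T} (S' : Sub (S ⊕ T)) (x : B S) (y : B T) → x · y ≡ 0#
               → restrict S (S' ∘ inj₁) x · restrict T (S' ∘ inj₂) y ≡ 0#
  restrict-·≡0 S' x y xy≡0 = relabel≡0⇒≡0 (split≅ _ _ S') (begin
    relabel (split≅ _ _ S') (restrict _ (S' ∘ inj₁) x · restrict _ (S' ∘ inj₂) y) ≡⟨ restrict-· S' x y ⟨
    restrict _ S' (x · y)                                                        ≡⟨ cong (restrict _ S') xy≡0 ⟩
    restrict _ S' 0#                                                             ≡⟨ restrict-0 S' ⟩
    0#                                                                           ∎)
    where open ≡-Reasoning

  ·≡0⇒≡0⊎≡0 : IsConnected 𝔹 isMonoid → ∀ {N M} (x : B N) (y : B M) → x · y ≡ 0# → x ≡ 0# ⊎ y ≡ 0#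
  ·≡0⇒≡0⊎≡0 connected {N} {M} x y xy≡0 = [ y|∅≡0⇒ , y|∅≡1⇒ ] (connected (relabel (none≅∅ M) y|∅))
    where
    onN : Sub (N ⊕ M)
    onN = [ (λ _ → true) , (λ _ → false) ]
    y|∅ : B (M ∣ (λ _ → false))
    y|∅ = restrict M (λ _ → false) y
    y|∅≡0⇒ : relabel (none≅∅ M) y|∅ ≡ 0# → x ≡ 0# ⊎ y ≡ 0#
    y|∅≡0⇒ e = inj₂ (restrict-none≡0⇒≡0 y (relabel≡0⇒≡0 (none≅∅ M) e))
    y|∅≡1⇒ : relabel (none≅∅ M) y|∅ ≡ 1# → x ≡ 0# ⊎ y ≡ 0#
    y|∅≡1⇒ e = inj₁ (restrict-all≡0⇒≡0 x (·-cancel-unitʳ _ (none≅∅ M) e (restrict-·≡0 onN x y xy≡0)))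

  ≡0⊎≡0⇒·≡0 : ∀ {N M} (x : B N) (y : B M) → x ≡ 0# ⊎ y ≡ 0# → x · y ≡ 0#
  ≡0⊎≡0⇒·≡0 x y (inj₁ refl) = ·-absorbˡ y
  ≡0⊎≡0⇒·≡0 x y (inj₂ refl) = ·-absorbʳ x

mainTheorem7 : (𝔹 : PointedSpecies) (bi : IsBimonoid 𝔹) → IsConnected 𝔹 (IsBimonoid.isMonoid bi) → ∀ {N M : FinSet} (x : PointedSpecies.B 𝔹 N) (y : PointedSpecies.B 𝔹 M) → ((IsMonoid._·_ (IsBimonoid.isMonoid bi) x y ≡ PointedSpecies.0# 𝔹 → (x ≡ PointedSpecies.0# 𝔹 ⊎ y ≡ PointedSpecies.0# 𝔹)) × ((x ≡ PointedSpecies.0# 𝔹 ⊎ y ≡ PointedSpecies.0# 𝔹) → IsMonoid._·_ (IsBimonoid.isMonoid bi) x y ≡ PointedSpecies.0# 𝔹))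
mainTheorem7 𝔹 bi connected x y = ·≡0⇒≡0⊎≡0 connected x y , ≡0⊎≡0⇒·≡0 x y
  where open BimonoidProperties bi
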